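{- Let $p(n)$ denote the number of positive integers $m \le n$ such that $B(m) = B(m^2)$, where $B(x)$ is the number of ones in the binary expansion of $x$. Then $p(n) \gg n^{0.025}$; that is, there is a constant $c>0$ such that $p(n) \ge c\, n^{0.025}$ for all positive integers $n$.
   Context: For a positive integer $x$, $B(x)$ denotes the sum of the binary digits of $x$ (its Hamming weight). A positive integer $m$ is called a (2,1,2)-number if $B(m)=B(m^2)$. -}

module Defs where

open import Data.Nat using (ℕ; zero; suc; _+_; _*_; _≟_)
open import Data.Nat.DivMod using (_/_; _%_)
open import Data.List using (List; length; filter; map; upTo)

bits : ℕ → ℕ → ℕ
bits zero    _ = 0
bits (suc f) x = x % 2 + bits f (x / 2)

-- B x = Hamming weight of x. Fuel x suffices since x has at most x binary digits.
B : ℕ → ℕ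
B x = bits x x

p : ℕ → ℕ
p n = length (filter (λ m → B m ≟ B (m * m)) (map suc (upTo n)))

{-# OPTIONS --safe #-}
module Submission where

-- Call y ≥ 1 admissible for K when B(y) + B(y²) = K + 1, and put m = (2^K − 1)·2^(L+1) − y
-- for L large.  In binary m is the (L+1)-bit complement of y − 1 with 2^K − 2 written above it,
-- and m² = y² + 2^(L+2)·w where w is d = 2^L − (2^K − 1)·y with (2^K − 2)·2^K written above it.
-- As B(a) + B(b) = N whenever a + b + 1 = 2^N, every digit sum involved reduces to B(y − 1),
-- B(y²) and B(e) for the K-bit complement e of y, and admissibility gives B(m) = B(m²).
-- For s < 2^h, y = 2^(2h+2) − 1 − s is admissible for some K ≥ 2h + 2: y² = (s + 1)² + g·2^(2h+3)
-- with g = 2^(2h+1) − 1 − s, so B(y) + B(y²) ≥ (2h + 2 − B(s)) + (2h + 1 − B(s)) ≥ 2h + 3.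
-- Since y = 2^(L+1) − (m mod 2^(L+1)), these 2^h numbers m < 2^(14h+14) are distinct,
-- whence n ≤ 2^28·p(n)^14, a stronger bound than the exponent 1/40.

open import Defs
open import Data.Nat
open import Data.Nat.Properties
open import Data.Nat.DivMod
open import Data.Nat.Divisibility using (divides-refl)
open import Data.Nat.Tactic.RingSolver
open import Data.Empty using (⊥-elim)
open import Data.Fin using (Fin; toℕ)
open import Data.Fin.Patterns using (0F; 1F)
open import Data.Fin.Properties using (toℕ<n; toℕ-injective; injective⇒≤)
open import Data.List using (List; length; filter; map; upTo)
open import Data.List.Membership.Propositional using (_∈_)
open import Data.List.Membership.Propositional.Properties using (∈-filter⁺; ∈-map⁺; ∈-upTo⁺)
import Data.List.Membership.Setoid.Properties as Membershipₛ
open import Data.Product using (Σ; _×_; _,_)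
open import Function using (_∘_)
open import Function.Definitions using (Injective)
open import Relation.Binary.PropositionalEquality
  using (_≡_; refl; sym; trans; cong; cong₂; subst; setoid; module ≡-Reasoning)
open import Relation.Nullary using (Dec; yes; no)

bits-zeroʳ : ∀ f → bits f 0 ≡ 0
bits-zeroʳ zero    = refl
bits-zeroʳ (suc f) = bits-zeroʳ f

n<2^n : ∀ n → n < 2 ^ n
n<2^n zero    = s≤s z≤n
n<2^n (suc n) = ≤-trans (+-mono-≤ (m^n>0 2 n) (n<2^n n)) (≤-reflexive (cong (2 ^ n +_) (sym (+-identityʳ (2 ^ n)))))

bits-fuel-irrelevant : ∀ {f g x} → x < 2 ^ f → x < 2 ^ g → bits f x ≡ bits g x
bits-fuel-irrelevant {zero}  {g}    (s≤s z≤n) _         = sym (bits-zeroʳ g)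
bits-fuel-irrelevant {suc f} {zero} _         (s≤s z≤n) = bits-zeroʳ (suc f)
bits-fuel-irrelevant {suc f} {suc g} {x} x<2^f x<2^g =
  cong (x % 2 +_) (bits-fuel-irrelevant {f} {g} (half f x<2^f) (half g x<2^g))
  where
  half : ∀ k → x < 2 ^ suc k → x / 2 < 2 ^ k
  half k x< = m<n*o⇒m/o<n (subst (x <_) (*-comm 2 (2 ^ k)) x<)

B[r+q*2]≡r+B[q] : ∀ {r} q → r < 2 → B (r + q * 2) ≡ r + B q
B[r+q*2]≡r+B[q] {r} q r<2 = begin
  B (r + q * 2)              ≡⟨ bits-fuel-irrelevant {r + q * 2} {suc q} (n<2^n (r + q * 2)) r+q*2<2^[1+q] ⟩
  bits (suc q) (r + q * 2)   ≡⟨ cong₂ _+_ last-digit (cong (bits q) quotient) ⟩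
  r + B q                    ∎
  where
  open ≡-Reasoning
  r+q*2<2^[1+q] : r + q * 2 < 2 ^ suc q
  r+q*2<2^[1+q] = ≤-trans (+-monoˡ-≤ (q * 2) r<2) (≤-trans (*-monoˡ-≤ 2 (n<2^n q)) (≤-reflexive (*-comm (2 ^ q) 2)))
  last-digit : (r + q * 2) % 2 ≡ r
  last-digit = trans ([m+kn]%n≡m%n r q 2) (m<n⇒m%n≡m r<2)
  quotient : (r + q * 2) / 2 ≡ q
  quotient = trans (+-distrib-/-∣ʳ r (divides-refl q)) (cong₂ _+_ (m<n⇒m/n≡0 r<2) (m*n/n≡m q 2))

B[b+a*2^n]≡B[b]+B[a] : ∀ n a {b} → b < 2 ^ n → B (b + a * 2 ^ n) ≡ B b + B a
B[b+a*2^n]≡B[b]+B[a] zero a {zero}  _        = cong B (*-identityʳ a)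
B[b+a*2^n]≡B[b]+B[a] zero _ {suc _} (s≤s ())
B[b+a*2^n]≡B[b]+B[a] (suc n) a {b} b<2^[1+n] with b divMod 2
... | result q r refl = begin
  B (toℕ r + q * 2 + a * (2 * 2 ^ n))  ≡⟨ cong B (regroup (toℕ r) q a (2 ^ n)) ⟩
  B (toℕ r + (q + a * 2 ^ n) * 2)      ≡⟨ B[r+q*2]≡r+B[q] (q + a * 2 ^ n) (toℕ<n r) ⟩
  toℕ r + B (q + a * 2 ^ n)            ≡⟨ cong (toℕ r +_) (B[b+a*2^n]≡B[b]+B[a] n a q<2^n) ⟩
  toℕ r + (B q + B a)                  ≡⟨ +-assoc (toℕ r) (B q) (B a) ⟨
  toℕ r + B q + B a                    ≡⟨ cong (_+ B a) (B[r+q*2]≡r+B[q] q (toℕ<n r)) ⟨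
  B (toℕ r + q * 2) + B a              ∎
  where
  open ≡-Reasoning
  regroup : ∀ r q a M → r + q * 2 + a * (2 * M) ≡ r + (q + a * M) * 2
  regroup = solve-∀
  q<2^n : q < 2 ^ n
  q<2^n = *-cancelˡ-< 2 q (2 ^ n) (≤-<-trans (≤-trans (≤-reflexive (*-comm 2 q)) (m≤n+m (q * 2) (toℕ r))) b<2^[1+n])

B[a*2^n]≡B[a] : ∀ n a → B (a * 2 ^ n) ≡ B a
B[a*2^n]≡B[a] n a = B[b+a*2^n]≡B[b]+B[a] n a (m^n>0 2 n)

B-complement : ∀ n a b → suc (a + b) ≡ 2 ^ n → B a + B b ≡ n
B-complement zero    zero    zero    refl = refl
B-complement zero    zero    (suc _) ()
B-complement zero    (suc _) _       ()
B-complement (suc n) a b eq with a divMod 2 | b divMod 2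
... | result qa 0F refl | result qb 0F refl =
  ⊥-elim (even≢odd (2 ^ n) (qa + qb) (trans (sym eq) (both-even qa qb)))
  where
  both-even : ∀ x y → suc (x * 2 + y * 2) ≡ suc (2 * (x + y))
  both-even = solve-∀
... | result qa 1F refl | result qb 1F refl =
  ⊥-elim (even≢odd (2 ^ n) (suc (qa + qb)) (trans (sym eq) (both-odd qa qb)))
  where
  both-odd : ∀ x y → suc (suc (x * 2 + suc (y * 2))) ≡ suc (2 * suc (x + y))
  both-odd = solve-∀
... | result qa 0F refl | result qb 1F refl = begin
  B (qa * 2) + B (1 + qb * 2)   ≡⟨ cong₂ _+_ (B[r+q*2]≡r+B[q] qa z<s) (B[r+q*2]≡r+B[q] qb (s≤s z<s)) ⟩
  B qa + suc (B qb)             ≡⟨ +-suc (B qa) (B qb) ⟩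
  suc (B qa + B qb)             ≡⟨ cong suc (B-complement n qa qb (*-cancelˡ-≡ _ _ 2 (trans (double qa qb) eq))) ⟩
  suc n                         ∎
  where
  open ≡-Reasoning
  double : ∀ x y → 2 * suc (x + y) ≡ suc (x * 2 + suc (y * 2))
  double = solve-∀
... | result qa 1F refl | result qb 0F refl = begin
  B (1 + qa * 2) + B (qb * 2)   ≡⟨ cong₂ _+_ (B[r+q*2]≡r+B[q] qa (s≤s z<s)) (B[r+q*2]≡r+B[q] qb z<s) ⟩
  suc (B qa + B qb)             ≡⟨ cong suc (B-complement n qa qb (*-cancelˡ-≡ _ _ 2 (trans (double qa qb) eq))) ⟩
  suc n                         ∎
  where
  open ≡-Reasoning
  double : ∀ x y → 2 * suc (x + y) ≡ suc (suc (x * 2 + y * 2))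
  double = solve-∀

x<2^n⇒B[x]≤n : ∀ n {x} → x < 2 ^ n → B x ≤ n
x<2^n⇒B[x]≤n n {x} x<2^n = begin
  B x                     ≤⟨ m≤m+n (B x) _ ⟩
  B x + B (2 ^ n ∸ suc x) ≡⟨ B-complement n x _ (m+[n∸m]≡n x<2^n) ⟩
  n                       ∎
  where open ≤-Reasoning

complement-double : ∀ n s g → g + suc s ≡ 2 ^ n → suc (suc (s + g * 2) + s) ≡ 2 ^ suc n
complement-double n s g g+s+1≡2^n = trans (lemma s g) (cong (2 *_) g+s+1≡2^n)
  where
  lemma : ∀ s g → suc (suc (s + g * 2) + s) ≡ 2 * (g + suc s)
  lemma = solve-∀

-- With R = 2^L and Q = 2^K this is m² = y² + A·(A − 2y) for m = A − y, A = (q + 1)·2R,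
-- where A·(A − 2y) = 4R·w because (q + 1)·y = R − d.
square-expansion : ∀ {y' q c d R Q} (let y = suc y') →
  c + y ≡ 2 * R → d + suc q * y ≡ R → q + 2 ≡ Q →
  (c + q * (2 * R)) * (c + q * (2 * R)) ≡ y * y + (d + q * Q * R) * (2 * (2 * R))
square-expansion {y'} {q} {c} {d} c+y≡2R refl refl with c-formula
  where
  c-formula : c ≡ (1 + q * 2) * suc y' + d * 2
  c-formula = +-cancelʳ-≡ (suc y') _ _ (trans c+y≡2R (2R≡c+y y' q d))
    where
    2R≡c+y : ∀ y' q d → 2 * (d + suc q * suc y') ≡ (1 + q * 2) * suc y' + d * 2 + suc y'
    2R≡c+y = solve-∀
... | refl = identity y' q d
  where
  identity : ∀ y' q d (let y = suc y'; R = d + suc q * y; c = (1 + q * 2) * y + d * 2) →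
    (c + q * (2 * R)) * (c + q * (2 * R)) ≡ y * y + (d + q * (q + 2) * R) * (2 * (2 * R))
  identity = solve-∀

module SquarePreserving (y' e d c K L : ℕ)
  (e+y+1≡2^K : e + suc (suc y') ≡ 2 ^ K)
  (d+[q+1]y≡2^L : d + suc (y' + e) * suc y' ≡ 2 ^ L)
  (c+y≡2^[1+L] : c + suc y' ≡ 2 ^ suc L)
  (B[y]+B[y*y]≡1+K : B (suc y') + B (suc y' * suc y') ≡ suc K)
  where

  private
    y : ℕ
    y = suc y'
    q : ℕ
    q = y' + e
    t : ℕ
    t = e + y' * 2 ^ K

  open ≡-Reasoning

  B[y*y]≡1+B[e] : B (y * y) ≡ suc (B e)
  B[y*y]≡1+B[e] = +-cancelˡ-≡ (B y) _ _ (begin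
    B y + B (y * y)  ≡⟨ B[y]+B[y*y]≡1+K ⟩
    suc K            ≡⟨ cong suc (B-complement K e y (trans (sym (+-suc e y)) e+y+1≡2^K)) ⟨
    suc (B e + B y)  ≡⟨ cong suc (+-comm (B e) (B y)) ⟩
    suc (B y + B e)  ≡⟨ +-suc (B y) (B e) ⟨
    B y + suc (B e)  ∎)

  t+d+1≡2^L : suc (t + d) ≡ 2 ^ L
  t+d+1≡2^L = begin
    suc (e + y' * 2 ^ K + d)        ≡⟨ cong (λ Q → suc (e + y' * Q + d)) e+y+1≡2^K ⟨
    suc (e + y' * (e + suc y) + d)  ≡⟨ expand y' e d ⟩
    d + suc q * y                   ≡⟨ d+[q+1]y≡2^L ⟩
    2 ^ L                           ∎
    where
    expand : ∀ y' e d → suc (e + y' * (e + suc (suc y')) + d) ≡ d + suc (y' + e) * suc y'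
    expand = solve-∀

  B[c]≡B[y*y]+B[d] : B c ≡ B (y * y) + B d
  B[c]≡B[y*y]+B[d] = +-cancelʳ-≡ (B y') _ _ (begin
    B c + B y'               ≡⟨ B-complement (suc L) c y' (trans (sym (+-suc c y')) c+y≡2^[1+L]) ⟩
    suc L                    ≡⟨ cong suc (B-complement L t d t+d+1≡2^L) ⟨
    suc (B t + B d)          ≡⟨ cong (λ b → suc (b + B d)) (B[b+a*2^n]≡B[b]+B[a] K y' e<2^K) ⟩
    suc (B e + B y' + B d)   ≡⟨ regroup (B e) (B y') (B d) ⟩
    suc (B e) + B d + B y'   ≡⟨ cong (λ b → b + B d + B y') B[y*y]≡1+B[e] ⟨
    B (y * y) + B d + B y'   ∎)
    where
    e<2^K : e < 2 ^ K
    e<2^K = subst (e <_) e+y+1≡2^K (m<m+n e z<s)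
    regroup : ∀ a b c → suc (a + b + c) ≡ suc a + c + b
    regroup = solve-∀

  B[m]≡B[m*m] : y * y < 2 ^ suc (suc L) → let m = c + q * 2 ^ suc L in B m ≡ B (m * m)
  B[m]≡B[m*m] y*y<2^[2+L] = begin
    B (c + q * 2 ^ suc L)            ≡⟨ B[b+a*2^n]≡B[b]+B[a] (suc L) q c<2^[1+L] ⟩
    B c + B q                        ≡⟨ cong (_+ B q) B[c]≡B[y*y]+B[d] ⟩
    B (y * y) + B d + B q            ≡⟨ +-assoc (B (y * y)) (B d) (B q) ⟩
    B (y * y) + (B d + B q)          ≡⟨ cong (B (y * y) +_) B[w]≡B[d]+B[q] ⟨
    B (y * y) + B w                  ≡⟨ B[b+a*2^n]≡B[b]+B[a] (suc (suc L)) w y*y<2^[2+L] ⟨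
    B (y * y + w * 2 ^ suc (suc L))  ≡⟨ cong B (square-expansion c+y≡2^[1+L] d+[q+1]y≡2^L q+2≡2^K) ⟨
    B ((c + q * 2 ^ suc L) * (c + q * 2 ^ suc L)) ∎
    where
    w : ℕ
    w = d + q * 2 ^ K * 2 ^ L
    c<2^[1+L] : c < 2 ^ suc L
    c<2^[1+L] = subst (c <_) c+y≡2^[1+L] (m<m+n c z<s)
    d<2^L : d < 2 ^ L
    d<2^L = subst (d <_) d+[q+1]y≡2^L (m<m+n d z<s)
    B[w]≡B[d]+B[q] : B w ≡ B d + B q
    B[w]≡B[d]+B[q] = trans (B[b+a*2^n]≡B[b]+B[a] L (q * 2 ^ K) d<2^L) (cong (B d +_) (B[a*2^n]≡B[a] K q))
    q+2≡2^K : q + 2 ≡ 2 ^ K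
    q+2≡2^K = trans (lemma y' e) e+y+1≡2^K
      where
      lemma : ∀ y' e → y' + e + 2 ≡ e + suc (suc y')
      lemma = solve-∀

B[y]+B[y*y]-lower-bound : ∀ h {s} g (let J = 2 + (h + h); y = suc (s + g * 2)) →
  s < 2 ^ h → g + suc s ≡ 2 ^ suc (h + h) → suc J ≤ B y + B (y * y)
B[y]+B[y*y]-lower-bound h {s} g s<2^h g+s+1≡2^[1+2h] = begin
  suc J                                    ≤⟨ +-cancelʳ-≤ (h + h) _ _ double-count ⟩
  B y + B g                                ≤⟨ +-monoʳ-≤ (B y) (m≤n+m (B g) (B (suc s * suc s))) ⟩
  B y + (B (suc s * suc s) + B g)          ≡⟨ cong (B y +_) (B[b+a*2^n]≡B[b]+B[a] (suc J) g [s+1]²<2^[1+J]) ⟨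
  B y + B (suc s * suc s + g * 2 ^ suc J)  ≡⟨ cong (λ x → B y + B x) y*y≡[s+1]²+g*2^[1+J] ⟨
  B y + B (y * y)                          ∎
  where
  open ≤-Reasoning
  J : ℕ
  J = 2 + (h + h)
  y : ℕ
  y = suc (s + g * 2)
  y*y≡[s+1]²+g*2^[1+J] : y * y ≡ suc s * suc s + g * 2 ^ suc J
  y*y≡[s+1]²+g*2^[1+J] = trans (expand s g) (cong (λ x → suc s * suc s + g * (2 * (2 * x))) g+s+1≡2^[1+2h])
    where
    expand : ∀ s g → suc (s + g * 2) * suc (s + g * 2) ≡ suc s * suc s + g * (2 * (2 * (g + suc s)))
    expand = solve-∀
  [s+1]²<2^[1+J] : suc s * suc s < 2 ^ suc J
  [s+1]²<2^[1+J] = begin-strict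
    suc s * suc s  ≤⟨ *-mono-≤ s<2^h s<2^h ⟩
    2 ^ h * 2 ^ h  ≡⟨ ^-distribˡ-+-* 2 h h ⟨
    2 ^ (h + h)    <⟨ ^-monoʳ-< 2 (s≤s (s≤s z≤n)) (m<n+m (h + h) {3} z<s) ⟩
    2 ^ suc J      ∎
  B[s]≤h : B s ≤ h
  B[s]≤h = x<2^n⇒B[x]≤n h s<2^h
  double-count : suc J + (h + h) ≤ B y + B g + (h + h)
  double-count = begin
    suc J + (h + h)          ≡⟨ +-suc J (h + h) ⟨
    J + suc (h + h)          ≡⟨ cong₂ _+_ (B-complement J y s (complement-double (suc (h + h)) s g g+s+1≡2^[1+2h]))
                                          (B-complement (suc (h + h)) g s (trans (sym (+-suc g s)) g+s+1≡2^[1+2h])) ⟨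
    B y + B s + (B g + B s)  ≡⟨ regroup (B y) (B s) (B g) ⟩
    B y + B g + (B s + B s)  ≤⟨ +-monoʳ-≤ (B y + B g) (+-mono-≤ B[s]≤h B[s]≤h) ⟩
    B y + B g + (h + h)      ∎
    where
    regroup : ∀ a b c → a + b + (c + b) ≡ a + c + (b + b)
    regroup = solve-∀

module Witness (h : ℕ) where

  J : ℕ
  J = 2 + (h + h)

  L : ℕ
  L = J * 4

  private
    instance
      2^[1+L]-nonZero : NonZero (2 ^ suc L)
      2^[1+L]-nonZero = m^n≢0 2 (suc L)
    2^-mono : ∀ {a b} → a ≤ b → 2 ^ a ≤ 2 ^ b
    2^-mono = ^-monoʳ-≤ 2

  module _ (s : ℕ) where

    g : ℕ
    g = 2 ^ suc (h + h) ∸ suc s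

    -- suc y' is y = 2^J − 1 − s
    y' : ℕ
    y' = s + g * 2

    K : ℕ
    K = B (suc y') + B (suc y' * suc y') ∸ 1

    e : ℕ
    e = 2 ^ K ∸ suc (suc y')

    d : ℕ
    d = 2 ^ L ∸ suc (y' + e) * suc y'

    c : ℕ
    c = 2 ^ suc L ∸ suc y'

    m : ℕ
    m = c + (y' + e) * 2 ^ suc L

    module _ (s<2^h : s < 2 ^ h) where

      private
        y : ℕ
        y = suc y'
        q : ℕ
        q = y' + e

      g+s+1≡2^[1+2h] : g + suc s ≡ 2 ^ suc (h + h)
      g+s+1≡2^[1+2h] = m∸n+n≡m (≤-trans s<2^h (2^-mono (≤-trans (m≤m+n h h) (n≤1+n _))))

      y+s+1≡2^J : suc (y + s) ≡ 2 ^ J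
      y+s+1≡2^J = complement-double (suc (h + h)) s g g+s+1≡2^[1+2h]

      y<2^J : y < 2 ^ J
      y<2^J = subst (y <_) y+s+1≡2^J (s≤s (m≤m+n y s))

      J<B[y]+B[y*y] : suc J ≤ B y + B (y * y)
      J<B[y]+B[y*y] = B[y]+B[y*y]-lower-bound h g s<2^h g+s+1≡2^[1+2h]

      B[y]+B[y*y]≡1+K : B y + B (y * y) ≡ suc K
      B[y]+B[y*y]≡1+K = sym (m+[n∸m]≡n (≤-trans (s≤s z≤n) J<B[y]+B[y*y]))

      J≤K : J ≤ K
      J≤K = ≤-pred (subst (suc J ≤_) B[y]+B[y*y]≡1+K J<B[y]+B[y*y])

      y*y<2^[J+J] : y * y < 2 ^ (J + J)
      y*y<2^[J+J] = <-≤-trans (*-mono-< y<2^J y<2^J) (≤-reflexive (sym (^-distribˡ-+-* 2 J J)))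

      1+K≤3J : suc K ≤ J + (J + J)
      1+K≤3J = subst (_≤ J + (J + J)) B[y]+B[y*y]≡1+K
                 (+-mono-≤ (x<2^n⇒B[x]≤n J y<2^J) (x<2^n⇒B[x]≤n (J + J) y*y<2^[J+J]))

      e+y+1≡2^K : e + suc y ≡ 2 ^ K
      e+y+1≡2^K = m∸n+n≡m (<-≤-trans y<2^J (2^-mono J≤K))

      q+1≤2^K : suc q ≤ 2 ^ K
      q+1≤2^K = subst (suc q ≤_) e+y+1≡2^K (≤-trans (n≤1+n (suc q)) (≤-reflexive (lemma y' e)))
        where
        lemma : ∀ y' e → suc (suc (y' + e)) ≡ e + suc (suc y')
        lemma = solve-∀

      d+[q+1]y≡2^L : d + suc q * y ≡ 2 ^ L
      d+[q+1]y≡2^L = m∸n+n≡m (begin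
        suc q * y        ≤⟨ *-mono-≤ q+1≤2^K (<⇒≤ y<2^J) ⟩
        2 ^ K * 2 ^ J    ≡⟨ ^-distribˡ-+-* 2 K J ⟨
        2 ^ (K + J)      ≤⟨ 2^-mono (≤-trans (+-monoˡ-≤ J (≤-trans (n≤1+n K) 1+K≤3J)) (≤-reflexive (lemma J))) ⟩
        2 ^ L            ∎)
        where
        open ≤-Reasoning
        lemma : ∀ J → J + (J + J) + J ≡ J * 4
        lemma = solve-∀

      y<2^[1+L] : y < 2 ^ suc L
      y<2^[1+L] = <-≤-trans y<2^J (2^-mono (≤-trans (m≤m*n J 4) (n≤1+n L)))

      c+y≡2^[1+L] : c + y ≡ 2 ^ suc L
      c+y≡2^[1+L] = m∸n+n≡m (<⇒≤ y<2^[1+L])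

      c<2^[1+L] : c < 2 ^ suc L
      c<2^[1+L] = subst (c <_) c+y≡2^[1+L] (m<m+n c z<s)

      y*y<2^[2+L] : y * y < 2 ^ suc (suc L)
      y*y<2^[2+L] = <-≤-trans y*y<2^[J+J] (2^-mono (≤-trans (m≤m+n (J + J) (J + J)) (≤-trans (≤-reflexive (lemma J)) (m≤n+m L 2))))
        where
        lemma : ∀ J → J + J + (J + J) ≡ J * 4
        lemma = solve-∀

      B[m]≡B[m*m] : B m ≡ B (m * m)
      B[m]≡B[m*m] = SquarePreserving.B[m]≡B[m*m] y' e d c K L
        e+y+1≡2^K d+[q+1]y≡2^L c+y≡2^[1+L] B[y]+B[y*y]≡1+K y*y<2^[2+L]

      m%2^[1+L]≡c : m % 2 ^ suc L ≡ c
      m%2^[1+L]≡c = trans ([m+kn]%n≡m%n c q (2 ^ suc L)) (m<n⇒m%n≡m c<2^[1+L])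

      1≤m : 1 ≤ m
      1≤m = ≤-trans (+-cancelʳ-< y 0 c (subst (y <_) (sym c+y≡2^[1+L]) y<2^[1+L])) (m≤m+n c _)

      m<2^[7J] : m < 2 ^ (J * 7)
      m<2^[7J] = begin-strict
        c + q * 2 ^ suc L   <⟨ +-monoˡ-< (q * 2 ^ suc L) c<2^[1+L] ⟩
        suc q * 2 ^ suc L   ≤⟨ *-monoˡ-≤ (2 ^ suc L) q+1≤2^K ⟩
        2 ^ K * 2 ^ suc L   ≡⟨ ^-distribˡ-+-* 2 K (suc L) ⟨
        2 ^ (K + suc L)     ≤⟨ 2^-mono (≤-trans (≤-reflexive (+-suc K L)) (≤-trans (+-monoˡ-≤ L 1+K≤3J) (≤-reflexive (lemma J)))) ⟩
        2 ^ (J * 7)         ∎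
        where
        open ≤-Reasoning
        lemma : ∀ J → J + (J + J) + J * 4 ≡ J * 7
        lemma = solve-∀

  m-injective : ∀ {s₁ s₂} → s₁ < 2 ^ h → s₂ < 2 ^ h → m s₁ ≡ m s₂ → s₁ ≡ s₂
  m-injective {s₁} {s₂} s₁<2^h s₂<2^h m₁≡m₂ = +-cancelˡ-≡ (suc (y' s₁)) s₁ s₂ (suc-injective (begin
    suc (suc (y' s₁) + s₁)  ≡⟨ y+s+1≡2^J s₁ s₁<2^h ⟩
    2 ^ J                   ≡⟨ y+s+1≡2^J s₂ s₂<2^h ⟨
    suc (suc (y' s₂) + s₂)  ≡⟨ cong (λ y → suc (y + s₂)) y₁≡y₂ ⟨
    suc (suc (y' s₁) + s₂)  ∎))
    where
    open ≡-Reasoning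
    c₁≡c₂ : c s₁ ≡ c s₂
    c₁≡c₂ = begin
      c s₁               ≡⟨ m%2^[1+L]≡c s₁ s₁<2^h ⟨
      m s₁ % 2 ^ suc L   ≡⟨ cong (_% 2 ^ suc L) m₁≡m₂ ⟩
      m s₂ % 2 ^ suc L   ≡⟨ m%2^[1+L]≡c s₂ s₂<2^h ⟩
      c s₂               ∎
    y₁≡y₂ : suc (y' s₁) ≡ suc (y' s₂)
    y₁≡y₂ = +-cancelˡ-≡ (c s₁) _ _ (begin
      c s₁ + suc (y' s₁)  ≡⟨ c+y≡2^[1+L] s₁ s₁<2^h ⟩
      2 ^ suc L           ≡⟨ c+y≡2^[1+L] s₂ s₂<2^h ⟨
      c s₂ + suc (y' s₂)  ≡⟨ cong (_+ suc (y' s₂)) c₁≡c₂ ⟨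
      c s₁ + suc (y' s₂)  ∎)

injection⇒≤length : ∀ {a} {A : Set a} {k} {xs : List A} (f : Fin k → A) →
  Injective _≡_ _≡_ f → (∀ i → f i ∈ xs) → k ≤ length xs
injection⇒≤length f f-injective f∈xs =
  injective⇒≤ (λ {i} {j} eq → f-injective (Membershipₛ.index-injective (setoid _) (f∈xs i) (f∈xs j) eq))

k≤p : ∀ {n k} (f : Fin k → ℕ) → Injective _≡_ _≡_ f →
  (∀ i → 1 ≤ f i) → (∀ i → f i ≤ n) → (∀ i → B (f i) ≡ B (f i * f i)) → k ≤ p n
k≤p {n} f f-injective 1≤f f≤n B[f]≡B[f*f] = injection⇒≤length f f-injective f∈
  where
  f∈ : ∀ i → f i ∈ filter (λ m → B m ≟ B (m * m)) (map suc (upTo n))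
  f∈ i with f i | 1≤f i | f≤n i | B[f]≡B[f*f] i
  ... | suc m | _ | m<n | B[m]≡B[m*m] = ∈-filter⁺ _ (∈-map⁺ suc (∈-upTo⁺ m<n)) B[m]≡B[m*m]

1≤p : ∀ {n} → 1 ≤ n → 1 ≤ p n
1≤p 1≤n = k≤p (λ _ → 1) (λ { {0F} {0F} _ → refl }) (λ _ → ≤-refl) (λ _ → 1≤n) (λ _ → refl)

2^h≤p : ∀ h {n} → 2 ^ (14 * suc h) ≤ n → 2 ^ h ≤ p n
2^h≤p h {n} 2^[14+14h]≤n = k≤p (m ∘ toℕ)
  (λ {i} {j} eq → toℕ-injective (m-injective (toℕ<n i) (toℕ<n j) eq))
  (λ i → 1≤m (toℕ i) (toℕ<n i))
  (λ i → ≤-trans (<⇒≤ (m<2^[7J] (toℕ i) (toℕ<n i))) (subst (λ x → 2 ^ x ≤ n) (exponent h) 2^[14+14h]≤n))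
  (λ i → B[m]≡B[m*m] (toℕ i) (toℕ<n i))
  where
  open Witness h
  exponent : ∀ h → 14 * suc h ≡ (2 + (h + h)) * 7
  exponent = solve-∀

n≤2^28*p[n]^14 : ∀ {n} → 1 ≤ n → n ≤ 2 ^ 28 * p n ^ 14
n≤2^28*p[n]^14 {n} 1≤n = below n n<2^[14+14n]
  where
  open ≤-Reasoning
  n<2^[14+14n] : n < 2 ^ (14 * suc n)
  n<2^[14+14n] = <-≤-trans (n<2^n n) (^-monoʳ-≤ 2 (≤-trans (n≤1+n n) (m≤n*m (suc n) 14)))
  below : ∀ h → n < 2 ^ (14 * suc h) → n ≤ 2 ^ 28 * p n ^ 14
  below zero n<2^14 = begin
    n                  ≤⟨ <⇒≤ n<2^14 ⟩
    2 ^ 14             ≤⟨ ^-monoʳ-≤ 2 (m≤m+n 14 14) ⟩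
    2 ^ 28 * 1 ^ 14    ≤⟨ *-monoʳ-≤ (2 ^ 28) (^-monoˡ-≤ 14 (1≤p 1≤n)) ⟩
    2 ^ 28 * p n ^ 14  ∎
  -- A helper rather than 'with', and explicit indices for cong: abstracting or unifying would
  -- unfold 2 ^ (14 * suc (suc h)) into a term of size 2^28.
  below (suc h) n<2^[28+14h] = by-cases (2 ^ (14 * suc h) ≤? n)
    where
    exponent : 14 * suc (suc h) ≡ 28 + h * 14
    exponent = trans (*-distribˡ-+ 14 2 h) (cong (28 +_) (*-comm 14 h))
    by-cases : Dec (2 ^ (14 * suc h) ≤ n) → n ≤ 2 ^ 28 * p n ^ 14
    by-cases (no  2^[14+14h]≰n) = below h (≰⇒> 2^[14+14h]≰n)
    by-cases (yes 2^[14+14h]≤n) = begin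
      n                       ≤⟨ <⇒≤ n<2^[28+14h] ⟩
      2 ^ (14 * suc (suc h))  ≡⟨ cong (2 ^_) {14 * suc (suc h)} {28 + h * 14} exponent ⟩
      2 ^ (28 + h * 14)       ≡⟨ ^-distribˡ-+-* 2 28 (h * 14) ⟩
      2 ^ 28 * 2 ^ (h * 14)   ≡⟨ cong (2 ^ 28 *_) (^-*-assoc 2 h 14) ⟨
      2 ^ 28 * (2 ^ h) ^ 14   ≤⟨ *-monoʳ-≤ (2 ^ 28) (^-monoˡ-≤ 14 (2^h≤p h 2^[14+14h]≤n)) ⟩
      2 ^ 28 * p n ^ 14       ∎

theorem1 : Σ ℕ (λ a → Σ ℕ (λ b → (0 < a) × (0 < b) × ((n : ℕ) → 1 ≤ n → a * n ≤ b * (p n ^ 40))))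
theorem1 = 1 , 2 ^ 28 , z<s , m^n>0 2 28 , λ n 1≤n → begin
  1 * n              ≡⟨ *-identityˡ n ⟩
  n                  ≤⟨ n≤2^28*p[n]^14 1≤n ⟩
  2 ^ 28 * p n ^ 14  ≤⟨ *-monoʳ-≤ (2 ^ 28) (^-monoʳ-≤ (p n) {{>-nonZero (1≤p 1≤n)}} (m≤m+n 14 26)) ⟩
  2 ^ 28 * p n ^ 40  ∎
  where open ≤-Reasoning
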